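{- (Duality Theorem) Let $\mathcal{X}$ and $\mathcal{Y}$ be disjoint finite sets and let $Q=\mathcal{Q}(\mathcal{X}\cup\mathcal{Y})$ be colored blue/red so that it contains no blue copy of $\Lambda$. Then $Q$ contains exactly one of the following: (a) a red $\mathcal{X}$-good copy of $\mathcal{Q}(\mathcal{X})$; or (b) a blue $\mathcal{Y}$-shrub.
   Context: $\mathcal{Q}(\mathcal{S})$ is the Boolean lattice of all subsets of $\mathcal{S}$ ordered by inclusion. An embedding of posets is an injective map $f$ with $a\le b$ iff $f(a)\le f(b)$; a copy of a poset is a subset isomorphic to it with inherited order; red/blue copy means all its elements are red/blue. $\Lambda$ is the poset on $Z_1,Z_2,Z_3$ with $Z_1<Z_3$, $Z_2<Z_3$, $Z_1,Z_2$ incomparable. An $\mathcal{X}$-good copy of $\mathcal{Q}(\mathcal{X})$ is the image of an embedding $\phi:\mathcal{Q}(\mathcal{X})\to Q$ with $\phi(X)\cap\mathcal{X}=X$ for all $X\subseteq\mathcal{X}$. An ordered subset of $\mathcal{Y}$ is a (possibly empty) subset with a linear order; $\underline{S}$ is its underlying set; $T\le_{\mathcal{O}}S$ means $T$ is a prefix of $S$. The factorial tree $\mathcal{O}(\mathcal{Y})$ is the poset of all ordered subsets of $\mathcal{Y}$ under $\le_{\mathcal{O}}$. A $\mathcal{Y}$-shrub is the image of an embedding $\tau:\mathcal{O}(\mathcal{Y})\to Q$ with $\tau(S)\cap\mathcal{Y}=\underline{S}$ for all $S\in\mathcal{O}(\mathcal{Y})$. -}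

module Defs where

open import Data.Nat using (ℕ)
open import Data.Fin using (Fin)
open import Data.Fin.Subset using (Subset; _⊆_; _∩_; _∪_; ⁅_⁆; ⊥; ⊤)
open import Data.List using (List; foldr)
open import Data.List.Relation.Unary.All using (All)
open import Data.List.Relation.Unary.Unique.Propositional using (Unique)
open import Data.List.Relation.Binary.Prefix.Heterogeneous using (Prefix)
open import Data.Product using (Σ; _×_; proj₁; ∃)
open import Data.Empty using () renaming (⊥ to Empty)
open import Relation.Binary.PropositionalEquality using (_≡_; _≢_)
open import Relation.Nullary using (¬_)
open import Function.Bundles using (_⇔_)

-- The ground set X ∪ Y is modelled as Fin n; X, Y are subsets of it.
data Colour : Set where
  red blue : Colour

Colouring : ℕ → Set
Colouring n = Subset n → Colour

BlueΛ : ∀ {n} → Colouring n → Set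
BlueΛ {n} c = Σ (Subset n) λ Z₁ → Σ (Subset n) λ Z₂ → Σ (Subset n) λ Z₃ →
  (Z₁ ⊆ Z₃ × Z₁ ≢ Z₃) × (Z₂ ⊆ Z₃ × Z₂ ≢ Z₃) × ¬ (Z₁ ⊆ Z₂) × ¬ (Z₂ ⊆ Z₁) ×
  c Z₁ ≡ blue × c Z₂ ≡ blue × c Z₃ ≡ blue

SubsetOf : ∀ {n} → Subset n → Set
SubsetOf {n} X = Σ (Subset n) λ A → A ⊆ X

RedGoodCopy : ∀ {n} → Colouring n → Subset n → Set
RedGoodCopy {n} c X = Σ (SubsetOf X → Subset n) λ φ →
  (∀ A B → φ A ≡ φ B → proj₁ A ≡ proj₁ B) ×
  (∀ A B → (proj₁ A ⊆ proj₁ B) ⇔ (φ A ⊆ φ B)) ×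
  (∀ A → φ A ∩ X ≡ proj₁ A) ×
  (∀ A → c (φ A) ≡ red)

-- Ordered subsets of Y: lists of distinct elements of Y (list order = linear order).
OrdSubset : ∀ {n} → Subset n → Set
OrdSubset {n} Y = Σ (List (Fin n)) λ xs → Unique xs × All (λ x → x Data.Fin.Subset.∈ Y) xs

underlying : ∀ {n} → List (Fin n) → Subset n
underlying = foldr (λ x s → ⁅ x ⁆ ∪ s) ⊥

_≤O_ : ∀ {n} {Y : Subset n} → OrdSubset Y → OrdSubset Y → Set
S ≤O T = Prefix _≡_ (proj₁ S) (proj₁ T)

BlueShrub : ∀ {n} → Colouring n → Subset n → Set
BlueShrub {n} c Y = Σ (OrdSubset Y → Subset n) λ τ →
  (∀ S T → τ S ≡ τ T → proj₁ S ≡ proj₁ T) ×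
  (∀ S T → (S ≤O T) ⇔ (τ S ⊆ τ T)) ×
  (∀ S → τ S ∩ Y ≡ underlying (proj₁ S)) ×
  (∀ S → c (τ S) ≡ blue)

{-# OPTIONS --safe #-}
-- Call Z a root if Z is blue and every y ∈ Y ∖ Z can be added to its Y-part by passing to a
-- larger root Z′ with Z′ ∩ Y = (Z ∩ Y) ∪ {y}. Blue Y-shrubs are exactly the unfoldings of roots
-- with empty Y-part; Λ-freeness is what keeps distinct branches apart.
--
-- Given such a root and a red X-good copy φ, climbing from the root through the Y-points of
-- φ(Z ∩ X) ends at some Z = φ(Z ∩ X), which is both blue and red.
--
-- Without such a root, put φ(A) = A ∪ h(A), where h(A) ⊆ Y is obtained from U(A) = ⋃_{C ⊊ A} h(C)
-- by greedily adding points of Y while A ∪ T is blue and no root lies above A with Y-part T.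
-- Induction on A shows no root lies above A with Y-part U(A): below such a root the blue sets
-- C ∪ U(C), C ⊊ A, form a chain by Λ-freeness, and its top C satisfies U(A) = h(C). Hence the
-- greedy process can only stop at a red set.
module Submission where

open import Defs
open import Data.Nat using (ℕ; zero; suc; _≤_; _+_)
import Data.Nat.Properties as ℕ
open import Data.Bool.Properties using () renaming (_≟_ to _≟ᵇ_)
open import Data.Fin using (Fin; zero; suc)
open import Data.Fin.Properties using (any?; all?; _≟_)
open import Data.Fin.Subset
open import Data.Fin.Subset.Properties
open import Data.Fin.Subset.Induction using (⊂-wellFounded; ⊃-wellFounded)
open import Data.Vec using ([]; _∷_; here; there)
open import Data.Vec.Properties using (≡-dec)
open import Data.List using (List; []; _∷_; _++_; [_]; foldl)
import Data.List.Membership.Propositional as List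
open import Data.List.Relation.Unary.All as All using (All; []; _∷_)
import Data.List.Relation.Unary.All.Properties as All
open import Data.List.Relation.Unary.AllPairs using ([]; _∷_)
open import Data.List.Relation.Unary.Any using (here; there)
open import Data.List.Relation.Unary.Unique.Propositional using (Unique)
import Data.List.Relation.Unary.Unique.Propositional.Properties as Unique
open import Data.List.Relation.Binary.Pointwise as Pointwise using (Pointwise-≡⇒≡)
open import Data.List.Relation.Binary.Prefix.Heterogeneous using (Prefix; []; _∷_; _++ᵖ_)
open import Data.List.Relation.Binary.Prefix.Heterogeneous.Properties using (antisym; fromPointwise)
open import Data.Product using (Σ; ∃; ∃-syntax; _×_; _,_; proj₁; proj₂)
open import Data.Sum as Sum using (_⊎_; inj₁; inj₂; [_,_]′)
open import Data.Empty using (⊥-elim)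
open import Function using (_∘_; id)
open import Function.Bundles using (mk⇔; Equivalence)
open import Induction.WellFounded using (module All; module FixPoint)
open import Relation.Binary.Construct.On as On using ()
open import Relation.Binary.PropositionalEquality
  using (_≡_; _≢_; refl; sym; trans; cong; cong₂; subst; subst₂; module ≡-Reasoning)
open import Relation.Nullary using (¬_; Dec; yes; no; contradiction)
open import Relation.Nullary.Decidable using (_×-dec_; ¬?; map′; decidable-stable)
open import Relation.Unary using (Pred; Decidable)

private variable
  n m : ℕ
  p q r : Subset n
  x : Fin n

infix 4 _≟ˢ_
_≟ˢ_ : (p q : Subset n) → Dec (p ≡ q)
_≟ˢ_ = ≡-dec _≟ᵇ_

p⊆q⇒p≡q⊎p⊂q : p ⊆ q → p ≡ q ⊎ p ⊂ q
p⊆q⇒p≡q⊎p⊂q {p = p} {q} p⊆q with any? (λ x → x ∈? q ×-dec ¬? (x ∈? p))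
... | yes (x , x∈q , x∉p) = inj₂ (p⊆q , x , x∈q , x∉p)
... | no ∄ = inj₁ (⊆-antisym p⊆q λ {x} x∈q →
  decidable-stable (x ∈? p) λ x∉p → ∄ (x , x∈q , x∉p))

p⊂q⇒p≢q : p ⊂ q → p ≢ q
p⊂q⇒p≢q p⊂q p≡q = ⊂-irref p≡q p⊂q

p⊆q∧x∉p⇒p⊆q-x : p ⊆ q → x ∉ p → p ⊆ q - x
p⊆q∧x∉p⇒p⊆q-x p⊆q x∉p y∈p = x∈p∧x≢y⇒x∈p-y (p⊆q y∈p) λ { refl → x∉p y∈p }

x∉p⇒p⊂p∪⁅x⁆ : x ∉ p → p ⊂ p ∪ ⁅ x ⁆
x∉p⇒p⊂p∪⁅x⁆ {x = x} x∉p = p⊆p∪q _ , x , q⊆p∪q _ _ (x∈⁅x⁆ x) , x∉p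

∪-least : p ⊆ r → q ⊆ r → p ∪ q ⊆ r
∪-least {p = p} {q = q} p⊆r q⊆r = [ p⊆r , q⊆r ]′ ∘ x∈p∪q⁻ p q

x∈p⇒⁅x⁆⊆p : x ∈ p → ⁅ x ⁆ ⊆ p
x∈p⇒⁅x⁆⊆p {x = x} x∈p y∈⁅x⁆ = subst (_∈ _) (sym (x∈⁅y⁆⇒x≡y x y∈⁅x⁆)) x∈p

p⊆q⇒p∩r⊆q∩r : p ⊆ q → p ∩ r ⊆ q ∩ r
p⊆q⇒p∩r⊆q∩r p⊆q x∈ = x∈p∩q⁺ (p⊆q (p∩q⊆p _ _ x∈) , p∩q⊆q _ _ x∈)

p∩q≡⊥⇒x∈p⇒x∉q : p ∩ q ≡ ⊥ → x ∈ p → x ∉ q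
p∩q≡⊥⇒x∈p⇒x∉q p∩q≡⊥ x∈p x∈q = ∉⊥ (subst (_ ∈_) p∩q≡⊥ (x∈p∩q⁺ (x∈p , x∈q)))

∪-∩-cancelˡ : (∀ {x} → x ∈ p → x ∉ r) → q ⊆ r → (p ∪ q) ∩ r ≡ q
∪-∩-cancelˡ {p = p} {q = q} p#r q⊆r = ⊆-antisym
  (λ x∈ → [ (λ x∈p → ⊥-elim (p#r x∈p (p∩q⊆q _ _ x∈))) , id ]′
             (x∈p∪q⁻ p q (p∩q⊆p _ _ x∈)))
  (λ x∈q → x∈p∩q⁺ (q⊆p∪q p q x∈q , q⊆r x∈q))

⋃∈ : (A : Subset m) → (∀ i → i ∈ A → Subset n) → Subset n
⋃∈ []            f = ⊥
⋃∈ (outside ∷ A) f = ⋃∈ A λ i i∈A → f (suc i) (there i∈A)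
⋃∈ (inside ∷ A)  f = f zero here ∪ ⋃∈ A λ i i∈A → f (suc i) (there i∈A)

⋃∈-upper : ∀ (A : Subset m) f {i} (i∈A : i ∈ A) → f i i∈A ⊆ ⋃∈ {n = n} A f
⋃∈-upper (inside ∷ A)  f here        = p⊆p∪q _
⋃∈-upper (inside ∷ A)  f (there i∈A) = q⊆p∪q _ _ ∘ ⋃∈-upper A _ i∈A
⋃∈-upper (outside ∷ A) f (there i∈A) = ⋃∈-upper A _ i∈A

⋃∈-least : ∀ (A : Subset m) f → (∀ i i∈A → f i i∈A ⊆ r) → ⋃∈ A f ⊆ r
⋃∈-least []            f f⊆r = ⊥-elim ∘ ∉⊥
⋃∈-least (outside ∷ A) f f⊆r = ⋃∈-least A _ λ i i∈A → f⊆r (suc i) (there i∈A)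
⋃∈-least (inside ∷ A)  f f⊆r =
  ∪-least (f⊆r zero here) (⋃∈-least A _ λ i i∈A → f⊆r (suc i) (there i∈A))

⋃∈-cong : ∀ (A : Subset m) {f g} → (∀ i i∈A → f i i∈A ≡ g i i∈A) →
          ⋃∈ {n = n} A f ≡ ⋃∈ A g
⋃∈-cong []            f≡g = refl
⋃∈-cong (outside ∷ A) f≡g = ⋃∈-cong A λ i i∈A → f≡g (suc i) (there i∈A)
⋃∈-cong (inside ∷ A)  f≡g =
  cong₂ _∪_ (f≡g zero here) (⋃∈-cong A λ i i∈A → f≡g (suc i) (there i∈A))

underlying-++ : ∀ (xs ys : List (Fin n)) → underlying (xs ++ ys) ≡ underlying xs ∪ underlying ys
underlying-++ []       ys = sym (∪-identityˡ _)
underlying-++ (x ∷ xs) ys = trans (cong (⁅ x ⁆ ∪_) (underlying-++ xs ys)) (sym (∪-assoc ⁅ x ⁆ _ _))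

∈⇒∈underlying : ∀ {xs : List (Fin n)} → x List.∈ xs → x ∈ underlying xs
∈⇒∈underlying (here refl)  = p⊆p∪q _ (x∈⁅x⁆ _)
∈⇒∈underlying (there x∈xs) = q⊆p∪q _ _ (∈⇒∈underlying x∈xs)

∃-maximal : ∀ {ℓ} {P : Pred (Subset n) ℓ} → Decidable P → P p →
            ∃[ M ] P M × ∀ {q} → P q → ¬ M ⊂ q
∃-maximal {ℓ = ℓ} {P = P} P? = All.wfRec ⊃-wellFounded _ (λ p → P p → ∃ Maximal) step _
  where
  Maximal : Pred (Subset _) ℓ
  Maximal M = P M × ∀ {q} → P q → ¬ M ⊂ q
  step : ∀ p → (∀ {q} → p ⊂ q → P q → ∃ Maximal) → P p → ∃ Maximal
  step p rec Pp with anySubset? (λ q → P? q ×-dec p ⊂? q)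
  ... | yes (q , Pq , p⊂q) = rec p⊂q Pq
  ... | no ∄ = p , Pp , λ Pq p⊂q → ∄ (_ , Pq , p⊂q)

_≟ᶜ_ : (a b : Colour) → Dec (a ≡ b)
red  ≟ᶜ red  = yes refl
red  ≟ᶜ blue = no λ ()
blue ≟ᶜ red  = no λ ()
blue ≟ᶜ blue = yes refl

≢blue⇒≡red : ∀ {a} → a ≢ blue → a ≡ red
≢blue⇒≡red {red}  _      = refl
≢blue⇒≡red {blue} a≢blue = contradiction refl a≢blue

red≢blue : red ≢ blue
red≢blue ()

blue-⊂-comparable : {c : Colouring n} → ¬ BlueΛ c → p ⊂ r → q ⊂ r →
                    c p ≡ blue → c q ≡ blue → c r ≡ blue → p ⊆ q ⊎ q ⊆ p
blue-⊂-comparable {p = p} {q = q} noΛ p⊂r q⊂r p-blue q-blue r-blue with p ⊆? q | q ⊆? p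
... | yes p⊆q | _       = inj₁ p⊆q
... | no _    | yes q⊆p = inj₂ q⊆p
... | no p⊈q  | no q⊈p  = ⊥-elim (noΛ (p , q , _ , (proj₁ p⊂r , p⊂q⇒p≢q p⊂r) ,
                            (proj₁ q⊂r , p⊂q⇒p≢q q⊂r) , p⊈q , q⊈p , p-blue , q-blue , r-blue))

module Partition {X Y : Subset n} (X∩Y≡⊥ : X ∩ Y ≡ ⊥) where

  ∈X⇒∉Y : x ∈ X → x ∉ Y
  ∈X⇒∉Y = p∩q≡⊥⇒x∈p⇒x∉q X∩Y≡⊥

  ∪-∩-Y : p ⊆ X → q ⊆ Y → (p ∪ q) ∩ Y ≡ q
  ∪-∩-Y p⊆X = ∪-∩-cancelˡ (∈X⇒∉Y ∘ p⊆X)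

  ∪-∩-X : p ⊆ X → q ⊆ Y → (p ∪ q) ∩ X ≡ p
  ∪-∩-X {p = p} {q = q} p⊆X q⊆Y =
    trans (cong (_∩ X) (∪-comm p q)) (∪-∩-cancelˡ (λ x∈q x∈X → ∈X⇒∉Y x∈X (q⊆Y x∈q)) p⊆X)

≡-by-cover : {X Y : Subset n} → X ∪ Y ≡ ⊤ → p ∩ X ≡ q ∩ X → p ∩ Y ≡ q ∩ Y → p ≡ q
≡-by-cover {p = p} {q = q} {X} {Y} X∪Y≡⊤ ∩X ∩Y = begin
  p                  ≡⟨ split p ⟩
  (p ∩ X) ∪ (p ∩ Y)  ≡⟨ cong₂ _∪_ ∩X ∩Y ⟩
  (q ∩ X) ∪ (q ∩ Y)  ≡⟨ split q ⟨
  q                  ∎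
  where
  open ≡-Reasoning
  split : ∀ s → s ≡ (s ∩ X) ∪ (s ∩ Y)
  split s = begin
    s                  ≡⟨ ∩-identityʳ s ⟨
    s ∩ ⊤              ≡⟨ cong (s ∩_) X∪Y≡⊤ ⟨
    s ∩ (X ∪ Y)        ≡⟨ ∩-distribˡ-∪ s X Y ⟩
    (s ∩ X) ∪ (s ∩ Y)  ∎

module Shrubs {n} (Y : Subset n) (c : Colouring n) where

  infix 4 _⊆⟨_⟩_
  _⊆⟨_⟩_ : Subset n → Fin n → Subset n → Set
  Z ⊆⟨ y ⟩ Z′ = Z ⊆ Z′ × Z′ ∩ Y ≡ (Z ∩ Y) ∪ ⁅ y ⁆

  _⊆⟨_⟩?_ : ∀ Z y Z′ → Dec (Z ⊆⟨ y ⟩ Z′)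
  Z ⊆⟨ y ⟩? Z′ = Z ⊆? Z′ ×-dec (Z′ ∩ Y ≟ˢ (Z ∩ Y) ∪ ⁅ y ⁆)

  module _ {Z Z′ : Subset n} {y : Fin n} (step : Z ⊆⟨ y ⟩ Z′) where

    ⊆⟨⟩-∈ : y ∈ Z′
    ⊆⟨⟩-∈ = p∩q⊆p _ _ (subst (y ∈_) (sym (proj₂ step)) (q⊆p∪q _ _ (x∈⁅x⁆ y)))

    ⊆⟨⟩-∉ : ∀ {w} → w ∈ Y → w ∉ Z → w ≢ y → w ∉ Z′
    ⊆⟨⟩-∉ w∈Y w∉Z w≢y w∈Z′ =
      [ w∉Z ∘ p∩q⊆p _ _ , w≢y ∘ x∈⁅y⁆⇒x≡y y ]′
        (x∈p∪q⁻ _ _ (subst (_ ∈_) (proj₂ step) (x∈p∩q⁺ (w∈Z′ , w∈Y))))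

    ⊆⟨⟩-⊂ : y ∉ Z → Z ∩ Y ⊂ Z′ ∩ Y
    ⊆⟨⟩-⊂ y∉Z = subst (Z ∩ Y ⊂_) (sym (proj₂ step)) (x∉p⇒p⊂p∪⁅x⁆ (y∉Z ∘ p∩q⊆p _ _))

  data Root (Z : Subset n) : Set where
    root : c Z ≡ blue → (∀ y → y ∈ Y → y ∉ Z → ∃[ Z′ ] Z ⊆⟨ y ⟩ Z′ × Root Z′) → Root Z

  Root⇒blue : ∀ {Z} → Root Z → c Z ≡ blue
  Root⇒blue (root Z-blue _) = Z-blue

  root? : ∀ Z → Dec (Root Z)
  root? = All.wfRec (On.wellFounded (_∩ Y) ⊃-wellFounded) _ (Dec ∘ Root) step
    where
    step : ∀ Z → (∀ {Z′} → Z ∩ Y ⊂ Z′ ∩ Y → Dec (Root Z′)) → Dec (Root Z)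
    step Z rec = map′ (λ (b , ext) → root b ext) (λ { (root b ext) → b , ext })
                      (c Z ≟ᶜ blue ×-dec all? extensible?)
      where
      successor? : ∀ {y} → y ∉ Z → ∀ Z′ → Dec (Z ⊆⟨ y ⟩ Z′ × Root Z′)
      successor? {y} y∉Z Z′ with Z ⊆⟨ y ⟩? Z′
      ... | yes st = map′ (st ,_) proj₂ (rec (⊆⟨⟩-⊂ st y∉Z))
      ... | no ¬st = no (¬st ∘ proj₁)
      extensible? : ∀ y → Dec (y ∈ Y → y ∉ Z → ∃[ Z′ ] Z ⊆⟨ y ⟩ Z′ × Root Z′)
      extensible? y with y ∈? Y | y ∈? Z
      ... | no y∉Y  | _       = yes λ y∈Y → contradiction y∈Y y∉Y
      ... | yes _   | yes y∈Z = yes λ _ y∉Z → contradiction y∈Z y∉Z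
      ... | yes y∈Y | no y∉Z  =
        map′ (λ ext _ _ → ext) (λ ext → ext y∈Y y∉Z) (anySubset? (successor? y∉Z))

  GroundRoot : Set
  GroundRoot = ∃[ Z ] Root Z × Z ∩ Y ≡ ⊥

  groundRoot? : Dec GroundRoot
  groundRoot? = anySubset? λ Z → root? Z ×-dec Z ∩ Y ≟ˢ ⊥

  shrub⇒root : BlueShrub c Y → GroundRoot
  shrub⇒root (τ , _ , τ-order , τ-∩Y , τ-blue) = τ ([] , [] , []) , τ-Root _ , τ-∩Y _
    where
    τ-Root : ∀ S → Root (τ S)
    τ-Root = All.wfRec (On.wellFounded (λ S → τ S ∩ Y) ⊃-wellFounded) _ (Root ∘ τ) step
      where
      step : ∀ S → (∀ {S′} → τ S ∩ Y ⊂ τ S′ ∩ Y → Root (τ S′)) → Root (τ S)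
      step S@(xs , xs-unique , xs⊆Y) rec = root (τ-blue S) extend
        where
        extend : ∀ y → y ∈ Y → y ∉ τ S → ∃[ Z′ ] τ S ⊆⟨ y ⟩ Z′ × Root Z′
        extend y y∈Y y∉τS = τ S′ , S⊆⟨y⟩S′ , rec (⊆⟨⟩-⊂ S⊆⟨y⟩S′ y∉τS)
          where
          y∉xs : ¬ y List.∈ xs
          y∉xs y∈xs = y∉τS (p∩q⊆p _ _ (subst (y ∈_) (sym (τ-∩Y S)) (∈⇒∈underlying y∈xs)))
          S′ : OrdSubset Y
          S′ = xs ++ [ y ]
             , Unique.++⁺ xs-unique ([] ∷ []) (λ { (y∈xs , here refl) → y∉xs y∈xs ; (_ , there ()) })
             , All.++⁺ xs⊆Y (y∈Y ∷ [])
          S⊆⟨y⟩S′ : τ S ⊆⟨ y ⟩ τ S′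
          S⊆⟨y⟩S′ = Equivalence.to (τ-order S S′) (fromPointwise (Pointwise.refl refl) ++ᵖ [ y ]) , (begin
            τ S′ ∩ Y                  ≡⟨ τ-∩Y S′ ⟩
            underlying (xs ++ [ y ])  ≡⟨ underlying-++ xs [ y ] ⟩
            underlying xs ∪ (⁅ y ⁆ ∪ ⊥) ≡⟨ cong₂ _∪_ (sym (τ-∩Y S)) (∪-identityʳ ⁅ y ⁆) ⟩
            (τ S ∩ Y) ∪ ⁅ y ⁆         ∎)
            where open ≡-Reasoning

  Node : Set
  Node = Σ (Subset n) Root

  child : Node → Fin n → Node
  child (Z , root b ext) y with y ∈? Y | y ∈? Z
  ... | yes y∈Y | no y∉Z = let (Z′ , _ , r′) = ext y y∈Y y∉Z in Z′ , r′
  ... | _       | _      = Z , root b ext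

  child-⊆ : ∀ G y → proj₁ G ⊆ proj₁ (child G y)
  child-⊆ (Z , root b ext) y with y ∈? Y | y ∈? Z
  ... | yes y∈Y | no y∉Z = proj₁ (proj₁ (proj₂ (ext y y∈Y y∉Z)))
  ... | yes _   | yes _  = id
  ... | no _    | _      = id

  child-step : ∀ G {y} → y ∈ Y → y ∉ proj₁ G → proj₁ G ⊆⟨ y ⟩ proj₁ (child G y)
  child-step (Z , root b ext) {y} y∈Y y∉Z with y ∈? Y | y ∈? Z
  ... | yes y∈Y′ | no y∉Z′ = proj₁ (proj₂ (ext y y∈Y′ y∉Z′))
  ... | yes _    | yes y∈Z = contradiction y∈Z y∉Z
  ... | no y∉Y   | _       = contradiction y∈Y y∉Y

  grow : Node → List (Fin n) → Node
  grow = foldl child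

  grow-⊆ : ∀ G ys → proj₁ G ⊆ proj₁ (grow G ys)
  grow-⊆ G []       = id
  grow-⊆ G (y ∷ ys) = grow-⊆ (child G y) ys ∘ child-⊆ G y

  grow-prefix : ∀ G {xs ys} → Prefix _≡_ xs ys → proj₁ (grow G xs) ⊆ proj₁ (grow G ys)
  grow-prefix G {ys = ys} []  = grow-⊆ G ys
  grow-prefix G (refl ∷ pre) = grow-prefix (child G _) pre

  Fresh : Node → List (Fin n) → Set
  Fresh G ys = Unique ys × All (λ y → y ∈ Y × y ∉ proj₁ G) ys

  Fresh-child : ∀ G {y ys} → Fresh G (y ∷ ys) → Fresh (child G y) ys
  Fresh-child G (y∉ys ∷ ys-unique , (y∈Y , y∉G) ∷ ys-fresh) =
    ys-unique , All.zipWith (λ (y≢w , w∈Y , w∉G) → w∈Y , ⊆⟨⟩-∉ G⊆⟨y⟩Gy w∈Y w∉G (y≢w ∘ sym))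
                            (y∉ys , ys-fresh)
    where
    G⊆⟨y⟩Gy : proj₁ G ⊆⟨ _ ⟩ proj₁ (child G _)
    G⊆⟨y⟩Gy = child-step G y∈Y y∉G

  grow-∩Y : ∀ G ys → Fresh G ys → proj₁ (grow G ys) ∩ Y ≡ (proj₁ G ∩ Y) ∪ underlying ys
  grow-∩Y G []       _ = sym (∪-identityʳ _)
  grow-∩Y G (y ∷ ys) fresh@(_ , (y∈Y , y∉G) ∷ _) = begin
    proj₁ (grow (child G y) ys) ∩ Y          ≡⟨ grow-∩Y (child G y) ys (Fresh-child G fresh) ⟩
    (proj₁ (child G y) ∩ Y) ∪ underlying ys  ≡⟨ cong (_∪ _) (proj₂ (child-step G y∈Y y∉G)) ⟩
    ((proj₁ G ∩ Y) ∪ ⁅ y ⁆) ∪ underlying ys  ≡⟨ ∪-assoc _ _ _ ⟩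
    (proj₁ G ∩ Y) ∪ underlying (y ∷ ys)      ∎
    where open ≡-Reasoning

  module _ (noΛ : ¬ BlueΛ c) where

    distinct-children-unbounded : ∀ G {x y W} → x ∈ Y → x ∉ proj₁ G → y ∈ Y → y ∉ proj₁ G →
                                  x ≢ y → proj₁ (child G x) ⊆ W → proj₁ (child G y) ⊆ W →
                                  c W ≢ blue
    distinct-children-unbounded G {x} {y} x∈Y x∉G y∈Y y∉G x≢y Gx⊆W Gy⊆W W-blue =
      [ (λ Gx⊆Gy → x∉Gy (Gx⊆Gy x∈Gx)) , (λ Gy⊆Gx → y∉Gx (Gy⊆Gx y∈Gy)) ]′
        (blue-⊂-comparable noΛ (Gx⊆W , _ , Gy⊆W y∈Gy , y∉Gx) (Gy⊆W , _ , Gx⊆W x∈Gx , x∉Gy)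
                              (Root⇒blue (proj₂ (child G _))) (Root⇒blue (proj₂ (child G _))) W-blue)
      where
      x∈Gx : x ∈ proj₁ (child G x)
      x∈Gx = ⊆⟨⟩-∈ (child-step G x∈Y x∉G)
      y∈Gy : y ∈ proj₁ (child G y)
      y∈Gy = ⊆⟨⟩-∈ (child-step G y∈Y y∉G)
      x∉Gy : x ∉ proj₁ (child G y)
      x∉Gy = ⊆⟨⟩-∉ (child-step G y∈Y y∉G) x∈Y x∉G x≢y
      y∉Gx : y ∉ proj₁ (child G x)
      y∉Gx = ⊆⟨⟩-∉ (child-step G x∈Y x∉G) y∈Y y∉G (x≢y ∘ sym)

    grow-⊆⇒prefix : ∀ G xs ys → Fresh G xs → Fresh G ys →
                    proj₁ (grow G xs) ⊆ proj₁ (grow G ys) → Prefix _≡_ xs ys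
    grow-⊆⇒prefix G []       ys       _ _ _ = []
    grow-⊆⇒prefix G (x ∷ xs) []       (_ , (x∈Y , x∉G) ∷ _) _ ⊆G =
      contradiction (⊆G (grow-⊆ (child G x) xs (⊆⟨⟩-∈ (child-step G x∈Y x∉G)))) x∉G
    grow-⊆⇒prefix G (x ∷ xs) (y ∷ ys) fx@(_ , (x∈Y , x∉G) ∷ _) fy@(_ , (y∈Y , y∉G) ∷ _) ⊆W
      with x ≟ y
    ... | yes refl = refl ∷ grow-⊆⇒prefix (child G x) xs ys (Fresh-child G fx) (Fresh-child G fy) ⊆W
    ... | no x≢y   = contradiction (Root⇒blue (proj₂ (grow G (y ∷ ys))))
                       (distinct-children-unbounded G x∈Y x∉G y∈Y y∉G x≢y
                          (⊆W ∘ grow-⊆ (child G x) xs) (grow-⊆ (child G y) ys))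

    root⇒shrub : GroundRoot → BlueShrub c Y
    root⇒shrub (Z , r , Z∩Y≡⊥) =
      τ , τ-injective , (λ S T → mk⇔ (grow-prefix G) (τ-reflects S T)) , τ-∩Y ,
      λ S → Root⇒blue (proj₂ (grow G (proj₁ S)))
      where
      G : Node
      G = Z , r
      τ : OrdSubset Y → Subset n
      τ S = proj₁ (grow G (proj₁ S))
      fresh : ∀ S → Fresh G (proj₁ S)
      fresh (_ , unique , ⊆Y) =
        unique , All.map (λ w∈Y → w∈Y , λ w∈Z → p∩q≡⊥⇒x∈p⇒x∉q Z∩Y≡⊥ w∈Z w∈Y) ⊆Y
      τ-reflects : ∀ S T → τ S ⊆ τ T → Prefix _≡_ (proj₁ S) (proj₁ T)
      τ-reflects S T = grow-⊆⇒prefix G (proj₁ S) (proj₁ T) (fresh S) (fresh T)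
      τ-injective : ∀ S T → τ S ≡ τ T → proj₁ S ≡ proj₁ T
      τ-injective S T τS≡τT = Pointwise-≡⇒≡ (antisym (λ x≡y _ → x≡y)
        (τ-reflects S T (⊆-reflexive τS≡τT)) (τ-reflects T S (⊆-reflexive (sym τS≡τT))))
      τ-∩Y : ∀ S → τ S ∩ Y ≡ underlying (proj₁ S)
      τ-∩Y S = trans (grow-∩Y G (proj₁ S) (fresh S)) (trans (cong (_∪ _) Z∩Y≡⊥) (∪-identityˡ _))

module Exclusivity {n} {X Y : Subset n} (X∪Y≡⊤ : X ∪ Y ≡ ⊤) (c : Colouring n) where
  open Shrubs Y c

  redCopy⇒¬groundRoot : RedGoodCopy c X → ¬ GroundRoot
  redCopy⇒¬groundRoot (φ , _ , φ-order , φ-∩X , φ-red) (Z₀ , r₀ , Z₀∩Y≡⊥) =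
    climb r₀ (subst (_⊆ _) (sym Z₀∩Y≡⊥) ⊥⊆)
    where
    φ̂ : Subset n → Subset n
    φ̂ Z = φ (Z ∩ X , p∩q⊆q Z X)
    climb : ∀ {Z} → Root Z → ¬ (Z ∩ Y ⊆ φ̂ Z)
    climb {Z} (root Z-blue ext) Z∩Y⊆φ̂Z with any? (λ y → y ∈? φ̂ Z ×-dec y ∈? Y ×-dec ¬? (y ∈? Z))
    ... | yes (y , y∈φ̂Z , y∈Y , y∉Z) with ext y y∈Y y∉Z
    ...   | Z′ , (Z⊆Z′ , Z′∩Y≡) , r′ =
      climb r′ (subst (_⊆ φ̂ Z′) (sym Z′∩Y≡)
                      (φ̂Z⊆φ̂Z′ ∘ ∪-least Z∩Y⊆φ̂Z (x∈p⇒⁅x⁆⊆p y∈φ̂Z)))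
      where
      φ̂Z⊆φ̂Z′ : φ̂ Z ⊆ φ̂ Z′
      φ̂Z⊆φ̂Z′ = Equivalence.to (φ-order _ _) (p⊆q⇒p∩r⊆q∩r Z⊆Z′)
    climb {Z} (root Z-blue ext) Z∩Y⊆φ̂Z | no ∄ =
      red≢blue (trans (sym (φ-red _)) (trans (cong c φ̂Z≡Z) Z-blue))
      where
      φ̂Z∩Y⊆Z : φ̂ Z ∩ Y ⊆ Z
      φ̂Z∩Y⊆Z x∈ =
        decidable-stable (_ ∈? Z) λ x∉Z → ∄ (_ , p∩q⊆p _ _ x∈ , p∩q⊆q _ _ x∈ , x∉Z)
      φ̂Z≡Z : φ̂ Z ≡ Z
      φ̂Z≡Z = ≡-by-cover X∪Y≡⊤ (φ-∩X _) (⊆-antisym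
        (λ x∈ → x∈p∩q⁺ (φ̂Z∩Y⊆Z x∈ , p∩q⊆q _ _ x∈))
        (λ x∈ → x∈p∩q⁺ (Z∩Y⊆φ̂Z x∈ , p∩q⊆q _ _ x∈)))

  redCopy-shrub-exclusive : ¬ (RedGoodCopy c X × BlueShrub c Y)
  redCopy-shrub-exclusive (copy , shrub) = redCopy⇒¬groundRoot copy (shrub⇒root shrub)

module Construction {n} {X Y : Subset n} (X∩Y≡⊥ : X ∩ Y ≡ ⊥) (c : Colouring n) where
  open Shrubs Y c
  open Partition X∩Y≡⊥

  RootOver : Subset n → Subset n → Set
  RootOver A T = ∃[ Z ] Root Z × A ⊆ Z × Z ∩ Y ≡ T

  rootOver? : ∀ A T → Dec (RootOver A T)
  rootOver? A T = anySubset? λ Z → root? Z ×-dec A ⊆? Z ×-dec Z ∩ Y ≟ˢ T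

  Admissible : Subset n → Subset n → Set
  Admissible A T = ¬ RootOver A T × c (A ∪ T) ≡ red

  Candidate : Subset n → Subset n → Fin n → Set
  Candidate A T y = y ∈ Y × y ∉ T × ¬ RootOver A (T ∪ ⁅ y ⁆)

  candidate? : ∀ A T y → Dec (Candidate A T y)
  candidate? A T y = y ∈? Y ×-dec ¬? (y ∈? T) ×-dec ¬? (rootOver? A (T ∪ ⁅ y ⁆))

  -- Fuel k = n always suffices: every step enlarges T.
  saturate : Subset n → ℕ → Subset n → Subset n
  saturate A zero    T = T
  saturate A (suc k) T with c (A ∪ T) | any? (candidate? A T)
  ... | blue | yes (y , _) = saturate A k (T ∪ ⁅ y ⁆)
  ... | _    | _           = T

  saturate-⊇ : ∀ A k T → T ⊆ saturate A k T
  saturate-⊇ A zero    T = id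
  saturate-⊇ A (suc k) T with c (A ∪ T) | any? (candidate? A T)
  ... | blue | yes (y , _) = saturate-⊇ A k (T ∪ ⁅ y ⁆) ∘ p⊆p∪q _
  ... | blue | no _        = id
  ... | red  | _           = id

  saturate-⊆Y : ∀ A k {T} → T ⊆ Y → saturate A k T ⊆ Y
  saturate-⊆Y A zero    T⊆Y = T⊆Y
  saturate-⊆Y A (suc k) {T} T⊆Y with c (A ∪ T) | any? (candidate? A T)
  ... | blue | yes (y , y∈Y , _) = saturate-⊆Y A k (∪-least T⊆Y (x∈p⇒⁅x⁆⊆p y∈Y))
  ... | blue | no _              = T⊆Y
  ... | red  | _                 = T⊆Y

  saturate-red : ∀ A k {T} → c (A ∪ T) ≡ red → saturate A k T ≡ T
  saturate-red A zero    _ = refl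
  saturate-red A (suc k) {T} A∪T-red with c (A ∪ T) | any? (candidate? A T)
  ... | red  | _ = refl
  ... | blue | _ = contradiction (sym A∪T-red) red≢blue

  blue⇒RootOver : ∀ {A T} → A ⊆ X → T ⊆ Y → c (A ∪ T) ≡ blue →
                  (∀ y → y ∈ Y → y ∉ T → RootOver A (T ∪ ⁅ y ⁆)) → RootOver A T
  blue⇒RootOver {A} {T} A⊆X T⊆Y A∪T-blue over =
    A ∪ T , root A∪T-blue ext , p⊆p∪q _ , ∪-∩-Y A⊆X T⊆Y
    where
    ext : ∀ y → y ∈ Y → y ∉ A ∪ T → ∃[ Z ] A ∪ T ⊆⟨ y ⟩ Z × Root Z
    ext y y∈Y y∉A∪T with over y y∈Y (y∉A∪T ∘ q⊆p∪q A T)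
    ... | Z , rZ , A⊆Z , Z∩Y≡ =
      Z , (∪-least A⊆Z (p∩q⊆p _ _ ∘ subst (_ ∈_) (sym Z∩Y≡) ∘ p⊆p∪q _) ,
           trans Z∩Y≡ (cong (_∪ ⁅ y ⁆) (sym (∪-∩-Y A⊆X T⊆Y)))) , rZ

  blue⇒candidate : ∀ {A T} → A ⊆ X → T ⊆ Y → ¬ RootOver A T → c (A ∪ T) ≡ blue →
                   ∃ (Candidate A T)
  blue⇒candidate A⊆X T⊆Y ¬over A∪T-blue = decidable-stable (any? (candidate? _ _)) λ ∄ →
    ¬over (blue⇒RootOver A⊆X T⊆Y A∪T-blue λ y y∈Y y∉T →
      decidable-stable (rootOver? _ _) λ ¬over′ → ∄ (y , y∈Y , y∉T , ¬over′))

  saturate-admissible : ∀ A k {T} → A ⊆ X → T ⊆ Y → ¬ RootOver A T → n ≤ k + ∣ T ∣ →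
                        Admissible A (saturate A k T)
  saturate-admissible A zero {T} A⊆X T⊆Y ¬over n≤∣T∣ = ¬over , ≢blue⇒≡red λ A∪T-blue →
    let (y , _ , y∉T , _) = blue⇒candidate A⊆X T⊆Y ¬over A∪T-blue
    in  y∉T (subst (y ∈_) (sym T≡⊤) ∈⊤)
    where
    T≡⊤ : T ≡ ⊤
    T≡⊤ = ∣p∣≡n⇒p≡⊤ (ℕ.≤-antisym (∣p∣≤n T) n≤∣T∣)
  saturate-admissible A (suc k) {T} A⊆X T⊆Y ¬over n≤ with c (A ∪ T) in colour | any? (candidate? A T)
  ... | red  | _    = ¬over , colour
  ... | blue | no ∄ = contradiction (blue⇒candidate A⊆X T⊆Y ¬over colour) ∄
  ... | blue | yes (y , y∈Y , y∉T , ¬over′) =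
    saturate-admissible A k A⊆X (∪-least T⊆Y (x∈p⇒⁅x⁆⊆p y∈Y)) ¬over′ (begin
      n                     ≤⟨ n≤ ⟩
      suc k + ∣ T ∣         ≡⟨ ℕ.+-suc k ∣ T ∣ ⟨
      k + suc ∣ T ∣         ≤⟨ ℕ.+-monoʳ-≤ k (p⊂q⇒∣p∣<∣q∣ (x∉p⇒p⊂p∪⁅x⁆ y∉T)) ⟩
      k + ∣ T ∪ ⁅ y ⁆ ∣     ∎)
    where open ℕ.≤-Reasoning

  h-step : ∀ A → (∀ {C} → C ⊂ A → Subset n) → Subset n
  h-step A rec = saturate A n (⋃∈ A λ i i∈A → rec (x∈p⇒p-x⊂p i∈A))

  h : Subset n → Subset n
  h = All.wfRec ⊂-wellFounded _ (λ _ → Subset n) h-step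

  -- By monotonicity of h, U A is the union of h C over all C ⊂ A (see h-⊂-U).
  U : Subset n → Subset n
  U A = ⋃∈ A λ i _ → h (A - i)

  h-unfold : ∀ A → h A ≡ saturate A n (U A)
  h-unfold A = FixPoint.unfold-wfRec ⊂-wellFounded (λ _ → Subset n) h-step
    (λ A rec≡ → cong (saturate A n) (⋃∈-cong A λ _ i∈A → rec≡ (x∈p⇒p-x⊂p i∈A)))

  U⊆h : ∀ A → U A ⊆ h A
  U⊆h A = subst (U A ⊆_) (sym (h-unfold A)) (saturate-⊇ A n (U A))

  U-least : ∀ {A W} → (∀ {C} → C ⊂ A → h C ⊆ W) → U A ⊆ W
  U-least {A} h⊆W = ⋃∈-least A _ λ _ i∈A → h⊆W (x∈p⇒p-x⊂p i∈A)

  h-red : ∀ {A} → c (A ∪ U A) ≡ red → h A ≡ U A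
  h-red {A} A∪UA-red = trans (h-unfold A) (saturate-red A n A∪UA-red)

  h-⊆Y : ∀ A → h A ⊆ Y
  h-⊆Y = All.wfRec ⊂-wellFounded _ (λ A → h A ⊆ Y) λ A rec →
    subst (_⊆ Y) (sym (h-unfold A)) (saturate-⊆Y A n (U-least rec))

  U⊆Y : ∀ A → U A ⊆ Y
  U⊆Y A = U-least {A} λ {C} _ → h-⊆Y C

  h-mono : ∀ {A B} → A ⊆ B → h A ⊆ h B
  h-mono {B = B} = All.wfRec ⊂-wellFounded _ (λ B → ∀ {A} → A ⊆ B → h A ⊆ h B) step B
    where
    step : ∀ B → (∀ {C} → C ⊂ B → ∀ {A} → A ⊆ C → h A ⊆ h C) → ∀ {A} → A ⊆ B → h A ⊆ h B
    step B rec A⊆B with p⊆q⇒p≡q⊎p⊂q A⊆B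
    ... | inj₁ refl = id
    ... | inj₂ (_ , j , j∈B , j∉A) =
      U⊆h B ∘ ⋃∈-upper B _ j∈B ∘ rec (x∈p⇒p-x⊂p j∈B) (p⊆q∧x∉p⇒p⊆q-x A⊆B j∉A)

  h-⊂-U : ∀ {C A} → C ⊂ A → h C ⊆ U A
  h-⊂-U {A = A} (C⊆A , j , j∈A , j∉C) = ⋃∈-upper A _ j∈A ∘ h-mono (p⊆q∧x∉p⇒p⊆q-x C⊆A j∉C)

  -- Where B ∪ U B is red, h B = U B brings nothing new: U A is generated by the blue levels below A.
  U-bounded : ∀ {A W} → (∀ {C} → C ⊂ A → c (C ∪ U C) ≡ blue → h C ⊆ W) → U A ⊆ W
  U-bounded {A} {W} blue⇒⊆W =
    U-least λ C⊂A → All.wfRec ⊂-wellFounded _ (λ B → B ⊂ A → h B ⊆ W) step _ C⊂A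
    where
    step : ∀ B → (∀ {C} → C ⊂ B → C ⊂ A → h C ⊆ W) → B ⊂ A → h B ⊆ W
    step B rec B⊂A with c (B ∪ U B) ≟ᶜ blue
    ... | yes B∪UB-blue = blue⇒⊆W B⊂A B∪UB-blue
    ... | no ¬blue      = subst (_⊆ W) (sym (h-red (≢blue⇒≡red ¬blue)))
                                (U-least λ C⊂B → rec C⊂B (⊂-trans C⊂B B⊂A))

  BlueBelow : Subset n → Subset n → Set
  BlueBelow A C = C ⊂ A × c (C ∪ U C) ≡ blue

  blueBelow? : ∀ A C → Dec (BlueBelow A C)
  blueBelow? A C = C ⊂? A ×-dec c (C ∪ U C) ≟ᶜ blue

  module _ (noΛ : ¬ BlueΛ c) where

    module _ {A Z} (A⊆X : A ⊆ X) (rZ : Root Z) (A⊆Z : A ⊆ Z) (Z∩Y≡UA : Z ∩ Y ≡ U A) where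

      level-⊂ : ∀ {C} → C ⊂ A → C ∪ U C ⊂ Z
      level-⊂ {C} C⊂A@(C⊆A , j , j∈A , j∉C) =
        ∪-least (A⊆Z ∘ C⊆A) (p∩q⊆p _ _ ∘ subst (_ ∈_) (sym Z∩Y≡UA) ∘ h-⊂-U C⊂A ∘ U⊆h C) ,
        j , A⊆Z j∈A , [ j∉C , ∈X⇒∉Y (A⊆X j∈A) ∘ U⊆Y C ]′ ∘ x∈p∪q⁻ _ _

      blue-levels-chain : ∀ {C D} → BlueBelow A C → BlueBelow A D → C ⊆ D ⊎ D ⊆ C
      blue-levels-chain (C⊂A , C-blue) (D⊂A , D-blue) =
        Sum.map (X-part C⊂A D⊂A) (X-part D⊂A C⊂A)
          (blue-⊂-comparable noΛ (level-⊂ C⊂A) (level-⊂ D⊂A) C-blue D-blue (Root⇒blue rZ))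
        where
        X-part : ∀ {C D} → C ⊂ A → D ⊂ A → C ∪ U C ⊆ D ∪ U D → C ⊆ D
        X-part {C} {D} C⊂A D⊂A = subst₂ _⊆_ (∪-∩-X (A⊆X ∘ proj₁ C⊂A) (U⊆Y C))
                                            (∪-∩-X (A⊆X ∘ proj₁ D⊂A) (U⊆Y D))
                               ∘ p⊆q⇒p∩r⊆q∩r

      U≡h-maximal : ∀ {M} → BlueBelow A M → (∀ {C} → BlueBelow A C → ¬ M ⊂ C) → U A ≡ h M
      U≡h-maximal {M} M-below M-max =
        ⊆-antisym (U-bounded λ C⊂A C-blue → h-mono (below-M (C⊂A , C-blue))) (h-⊂-U (proj₁ M-below))
        where
        below-M : ∀ {C} → BlueBelow A C → C ⊆ M
        below-M C-below with blue-levels-chain C-below M-below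
        ... | inj₁ C⊆M = C⊆M
        ... | inj₂ M⊆C = [ ⊆-reflexive ∘ sym , (λ M⊂C → contradiction M⊂C (M-max C-below)) ]′
                           (p⊆q⇒p≡q⊎p⊂q M⊆C)

    module _ (noRoot : ¬ GroundRoot) where

      U-avoids : ∀ {A} → A ⊆ X → (∀ {C} → C ⊂ A → ¬ RootOver C (h C)) → ¬ RootOver A (U A)
      U-avoids {A} A⊆X h-avoids (Z , rZ , A⊆Z , Z∩Y≡UA) with anySubset? (blueBelow? A)
      ... | no ∄ = noRoot (Z , rZ , trans Z∩Y≡UA
                    (⊆-antisym (U-bounded λ C⊂A C-blue → contradiction (_ , C⊂A , C-blue) ∄) ⊥⊆))
      ... | yes (_ , C-below) with ∃-maximal (blueBelow? A) C-below
      ...   | M , M-below , M-max = h-avoids (proj₁ M-below)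
              (Z , rZ , A⊆Z ∘ proj₁ (proj₁ M-below) ,
               trans Z∩Y≡UA (U≡h-maximal A⊆X rZ A⊆Z Z∩Y≡UA M-below M-max))

      h-admissible : ∀ {A} → A ⊆ X → Admissible A (h A)
      h-admissible {A} = All.wfRec ⊂-wellFounded _ (λ A → A ⊆ X → Admissible A (h A)) step A
        where
        step : ∀ A → (∀ {C} → C ⊂ A → C ⊆ X → Admissible C (h C)) → A ⊆ X → Admissible A (h A)
        step A rec A⊆X = subst (Admissible A) (sym (h-unfold A))
          (saturate-admissible A n A⊆X (U⊆Y A) (U-avoids A⊆X λ C⊂A → proj₁ (rec C⊂A (A⊆X ∘ proj₁ C⊂A)))
                            (ℕ.m≤m+n n _))

      redCopy : RedGoodCopy c X
      redCopy = φ , φ-injective , (λ A B → mk⇔ (φ-mono A B) (φ-reflects A B)) , φ-∩X ,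
                λ (_ , A⊆X) → proj₂ (h-admissible A⊆X)
        where
        φ : SubsetOf X → Subset n
        φ (A , _) = A ∪ h A
        φ-∩X : ∀ A → φ A ∩ X ≡ proj₁ A
        φ-∩X (A , A⊆X) = ∪-∩-X A⊆X (h-⊆Y A)
        φ-mono : ∀ A B → proj₁ A ⊆ proj₁ B → φ A ⊆ φ B
        φ-mono _ _ A⊆B = ∪-least (p⊆p∪q _ ∘ A⊆B) (q⊆p∪q _ _ ∘ h-mono A⊆B)
        φ-reflects : ∀ A B → φ A ⊆ φ B → proj₁ A ⊆ proj₁ B
        φ-reflects A B = subst₂ _⊆_ (φ-∩X A) (φ-∩X B) ∘ p⊆q⇒p∩r⊆q∩r
        φ-injective : ∀ A B → φ A ≡ φ B → proj₁ A ≡ proj₁ B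
        φ-injective A B φA≡φB = trans (sym (φ-∩X A)) (trans (cong (_∩ X) φA≡φB) (φ-∩X B))

theorem12 : (n : ℕ) (X Y : Subset n) → X ∩ Y ≡ ⊥ → X ∪ Y ≡ ⊤ →
    (c : Colouring n) → ¬ BlueΛ c →
    (RedGoodCopy c X ⊎ BlueShrub c Y) × ¬ (RedGoodCopy c X × BlueShrub c Y)
theorem12 n X Y X∩Y≡⊥ X∪Y≡⊤ c noΛ =
  copy-or-shrub groundRoot? , redCopy-shrub-exclusive
  where
  open Shrubs Y c
  open Exclusivity X∪Y≡⊤ c
  open Construction X∩Y≡⊥ c
  copy-or-shrub : Dec GroundRoot → RedGoodCopy c X ⊎ BlueShrub c Y
  copy-or-shrub (yes r) = inj₂ (root⇒shrub noΛ r)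
  copy-or-shrub (no ∄)  = inj₁ (redCopy noΛ ∄)
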